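{- For $r \geq 1$ let $c_r = a \ast b_r$ (Dirichlet convolution), where $a(n) = (-1)^{n+1}$ and $b_r$ is the multiplicative arithmetic function with $b_r(p^e) = (-1)^e p^{\binom e2}\binom{r}{e}_p$ for every prime power $p^e$. Then $c_1(1)=1$, $c_1(2)=-2$, $c_1(n)=0$ for $n\geq 3$, and \[ c_{r+1}(n) = n\big(b_r(n) - b_r(n/2)\big) \] for all $r,n\geq 1$, where $b_r(n/2)$ is interpreted as $0$ for odd $n$.
   Context: Dirichlet convolution: $(f\ast g)(n) = \sum_{d_1d_2=n} f(d_1)g(d_2)$. The $p$-binomial coefficient is $\binom{r}{e}_p = \frac{(p^r-1)(p^r-p)\cdots(p^r-p^{e-1})}{(p^e-1)(p^e-p)\cdots(p^e-p^{e-1})}$, the number of $e$-dimensional subspaces of $\mathbf{F}_p^r$ (equal to $1$ for $e=0$ and $0$ for $e>r$). -}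

module Defs where

open import Data.Nat as ℕ using (ℕ; zero; suc; _∸_; _≤_)
open import Data.Nat.DivMod using (_/_)
open import Data.Nat.Divisibility using (_∣?_)
open import Data.Nat.Primality using (prime?)
open import Data.Nat.Combinatorics using (_C_)
open import Data.Integer as ℤ using (ℤ; +_; -[1+_])
open import Data.Bool using (Bool; true; false; if_then_else_)
open import Data.List using (List; []; _∷_; map; filter; foldr; upTo)
open import Relation.Nullary.Decidable using (does; ⌊_⌋)

prodℕ : ℕ → (ℕ → ℕ) → ℕ
prodℕ zero    f = 1
prodℕ (suc e) f = prodℕ e f ℕ.* f e

_÷_ : ℕ → ℕ → ℕ
m ÷ zero  = 0
m ÷ suc d = m / suc d

-- p-binomial coefficient (r choose e)_p, as in the paper:
-- ∏_{i<e} (p^r - p^i) / ∏_{i<e} (p^e - p^i).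
-- (For e > r the numerator has the factor p^r - p^r = 0, so the value is 0.)
pbinom : ℕ → ℕ → ℕ → ℕ
pbinom p r e = prodℕ e (λ i → p ℕ.^ r ∸ p ℕ.^ i) ÷ prodℕ e (λ i → p ℕ.^ e ∸ p ℕ.^ i)

sgn : ℕ → ℤ
sgn e = -[1+ 0 ] ℤ.^ e

bpp : ℕ → ℕ → ℕ → ℤ
bpp r p e = sgn e ℤ.* + (p ℕ.^ (e C 2) ℕ.* pbinom p r e)

-- p-adic valuation v_p(n) (for p ≥ 2, n ≥ 1), computed with fuel n
vAux : ℕ → ℕ → ℕ → ℕ
vAux zero    p n = 0
vAux (suc k) p n with does (2 ℕ.≤? p) | does (1 ℕ.≤? n) | does (p ∣? n)
... | true | true | true = suc (vAux k p (n ÷ p))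
... | _    | _    | _    = 0

val : ℕ → ℕ → ℕ
val p n = vAux n p n

primesUpTo : ℕ → List ℕ
primesUpTo n = filter prime? (upTo (suc n))

prodℤ : List ℤ → ℤ
prodℤ = foldr ℤ._*_ (+ 1)

sumℤ : List ℤ → ℤ
sumℤ = foldr ℤ._+_ (+ 0)

-- b_r: the multiplicative function with b_r(p^e) = bpp r p e, i.e.
-- b_r(n) = ∏_{p prime, p ≤ n} b_r(p^{v_p(n)})  (n ≥ 1; note b_r(p^0) = 1).
b : ℕ → ℕ → ℤ
b r n = prodℤ (map (λ p → bpp r p (val p n)) (primesUpTo n))

a : ℕ → ℤ
a n = sgn (suc n)

divisors : ℕ → List ℕ
divisors n = filter (λ d → d ∣? n) (map suc (upTo n))

_∗_ : (ℕ → ℤ) → (ℕ → ℤ) → ℕ → ℤ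
(f ∗ g) n = sumℤ (map (λ d → f d ℤ.* g (n ÷ d)) (divisors n))

c : ℕ → ℕ → ℤ
c r = a ∗ b r

bHalf : ℕ → ℕ → ℤ
bHalf r n = if does (2 ∣? n) then b r (n ÷ 2) else + 0

-- Both sides are determined by their behaviour at prime powers.  Call f multiplicative
-- at p with local factors F when f(p^i d) = F(i) f(d) for all d ≥ 1 prime to p.
--   * Divisor sums over p^e m (p ∤ m) split as Σ_{i ≤ e} Σ_{d ∣ m} F(p^i d); hence a
--     Dirichlet convolution of functions multiplicative at p is multiplicative at p,
--     with the convolved local factors (∗-multiplicativeAt).
--   * b_r is multiplicative at every prime with local factors b_r(p^e), via the p-adic
--     valuation computed by Defs; a is multiplicative since it only sees parity.
--   * The p-binomials satisfy the q-Pascal rule, so that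
--     b_{r+1}(p^(e+1)) = p^(e+1) b_r(p^(e+1)) - p^e b_r(p^e);  telescoping gives the local
--     factors of c_{r+1} (p odd and p = 2 separately), and they are those of R_r.
--   * Two functions with the same local factors at every prime that agree at 1 agree on
--     all n ≥ 1 (strong induction on n); for r = 0 one adds b_0(n) = 0 for n ≥ 2.
module Submission where

open import Function using (_∘_)
open import Data.Bool using (true; false; if_then_else_)
open import Data.Empty using (⊥-elim)
open import Data.Sum using (inj₁; inj₂)
open import Data.Product using (_×_; _,_; proj₁; proj₂)
open import Data.List using (List; []; _∷_; map; filter; foldr; upTo; _∷ʳ_)
import Data.List.Properties as ListP
open import Data.List.Relation.Unary.All using (_∷_)
open import Data.Nat as ℕ using (ℕ; zero; suc; _≤_; _<_; z≤n; s≤s; _^_)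
import Data.Nat.Properties as ℕP
import Data.Nat.DivMod
open import Data.Nat.ListAction using (product)
open import Data.Nat.Induction using (<-rec)
open import Data.Nat.Divisibility
  using (_∣_; _∤_; _∣?_; divides; ∣-refl; ∣-trans; n∣m*n; m∣m*n; ∣⇒≤; >⇒∤; ∣1⇒≡1;
         ∣m∣n⇒∣m+n; ∣m+n∣m⇒∣n; *-monoˡ-∣; *-cancelʳ-∣)
open import Data.Nat.Coprimality using (Coprime; coprime-divisor)
open import Data.Nat.Primality using (Prime; prime?; prime[2]; prime⇒irreducible; euclidsLemma; ¬prime[1])
open import Data.Nat.Primality.Factorisation using (factorise)
open import Data.Nat.Combinatorics using (_C_; nC1≡n; nCk+nC[k+1]≡[n+1]C[k+1])
import Data.Nat.Tactic.RingSolver as ℕSolver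
open import Data.Integer using (ℤ; +_; -[1+_]; _*_; _-_; _+_; -_)
import Data.Integer.Properties as ℤP
open import Data.Integer.Tactic.RingSolver using (solve-∀)
open import Relation.Nullary using (¬_; Dec; yes; no; does)
open import Relation.Nullary.Decidable using (dec-true; dec-false)
open import Relation.Unary using (Decidable)
open import Relation.Binary.PropositionalEquality
open import Algebra.Definitions {A = ℤ} _≡_ using (Associative; Identity)
import Algebra.Properties.CommutativeSemigroup as CommSemigroupProps

open import Defs

module ℕ* = CommSemigroupProps ℕP.*-commutativeSemigroup
module ℤ* = CommSemigroupProps ℤP.*-commutativeSemigroup
module ℤ+ = CommSemigroupProps ℤP.+-commutativeSemigroup

module MonoidFold (_∙_ : ℤ → ℤ → ℤ) (ε : ℤ) (assoc : Associative _∙_) (identity : Identity ε _∙_) where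

  fold : List ℤ → ℤ
  fold = foldr _∙_ ε

  fold-filter : ∀ {P : ℕ → Set} (P? : Decidable P) (h : ℕ → ℤ) xs →
    fold (map h (filter P? xs)) ≡ fold (map (λ x → if does (P? x) then h x else ε) xs)
  fold-filter P? h [] = refl
  fold-filter P? h (x ∷ xs) with does (P? x)
  ... | true  = cong (h x ∙_) (fold-filter P? h xs)
  ... | false = trans (fold-filter P? h xs) (sym (proj₁ identity _))

  fold-∷ʳ : ∀ (h : ℕ → ℤ) xs x → fold (map h (xs ∷ʳ x)) ≡ fold (map h xs) ∙ h x
  fold-∷ʳ h []       x = trans (proj₂ identity (h x)) (sym (proj₁ identity (h x)))
  fold-∷ʳ h (y ∷ xs) x = trans (cong (h y ∙_) (fold-∷ʳ h xs x)) (sym (assoc (h y) _ (h x)))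

  fold-upTo : ∀ (h : ℕ → ℤ) n → fold (map h (upTo (suc n))) ≡ fold (map h (upTo n)) ∙ h n
  fold-upTo h n = trans (cong (fold ∘ map h) (sym (ListP.upTo-∷ʳ n))) (fold-∷ʳ h (upTo n) n)

module SumFold  = MonoidFold _+_ (+ 0) ℤP.+-assoc ℤP.+-identity
module ProdFold = MonoidFold _*_ (+ 1) ℤP.*-assoc ℤP.*-identity

if-yes : ∀ {P : Set} (P? : Dec P) {x y : ℤ} → P → (if does P? then x else y) ≡ x
if-yes P? p rewrite dec-true P? p = refl

if-no : ∀ {P : Set} (P? : Dec P) {x y : ℤ} → ¬ P → (if does P? then x else y) ≡ y
if-no P? ¬p rewrite dec-false P? ¬p = refl

sum₁ : ℕ → (ℕ → ℤ) → ℤ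
sum₁ zero    F = + 0
sum₁ (suc K) F = sum₁ K F + F (suc K)

prod₀ : ℕ → (ℕ → ℤ) → ℤ
prod₀ zero    F = + 1
prod₀ (suc K) F = prod₀ K F * F K

sum₀ : ℕ → (ℕ → ℤ) → ℤ
sum₀ zero    G = G 0
sum₀ (suc e) G = G 0 + sum₀ e (G ∘ suc)

sum₁-list : ∀ (F : ℕ → ℤ) K → sumℤ (map (F ∘ suc) (upTo K)) ≡ sum₁ K F
sum₁-list F zero    = refl
sum₁-list F (suc K) = trans (SumFold.fold-upTo (F ∘ suc) K) (cong (_+ F (suc K)) (sum₁-list F K))

prod₀-list : ∀ (F : ℕ → ℤ) K → prodℤ (map F (upTo K)) ≡ prod₀ K F
prod₀-list F zero    = refl
prod₀-list F (suc K) = trans (ProdFold.fold-upTo F K) (cong (_* F K) (prod₀-list F K))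

sum₁-cong : ∀ K {F G : ℕ → ℤ} → (∀ d → 1 ≤ d → d ≤ K → F d ≡ G d) → sum₁ K F ≡ sum₁ K G
sum₁-cong zero    F≗G = refl
sum₁-cong (suc K) F≗G =
  cong₂ _+_ (sum₁-cong K (λ d 1≤d d≤K → F≗G d 1≤d (ℕP.m≤n⇒m≤1+n d≤K))) (F≗G (suc K) (s≤s z≤n) ℕP.≤-refl)

sum₁-zero : ∀ K {F : ℕ → ℤ} → (∀ d → 1 ≤ d → d ≤ K → F d ≡ + 0) → sum₁ K F ≡ + 0
sum₁-zero zero    F≗0 = refl
sum₁-zero (suc K) F≗0 =
  cong₂ _+_ (sum₁-zero K (λ d 1≤d d≤K → F≗0 d 1≤d (ℕP.m≤n⇒m≤1+n d≤K))) (F≗0 (suc K) (s≤s z≤n) ℕP.≤-refl)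

sum₁-+ : ∀ K (F G : ℕ → ℤ) → sum₁ K (λ d → F d + G d) ≡ sum₁ K F + sum₁ K G
sum₁-+ zero    F G = refl
sum₁-+ (suc K) F G =
  trans (cong (_+ (F (suc K) + G (suc K))) (sum₁-+ K F G)) (ℤ+.interchange (sum₁ K F) (sum₁ K G) (F (suc K)) (G (suc K)))

sum₁-scale : ∀ K (x : ℤ) (F : ℕ → ℤ) → sum₁ K (λ d → x * F d) ≡ x * sum₁ K F
sum₁-scale zero    x F = sym (ℤP.*-zeroʳ x)
sum₁-scale (suc K) x F =
  trans (cong (_+ (x * F (suc K))) (sum₁-scale K x F)) (sym (ℤP.*-distribˡ-+ x (sum₁ K F) (F (suc K))))

sum₁-split : ∀ L k (F : ℕ → ℤ) → sum₁ (L ℕ.+ k) F ≡ sum₁ L F + sum₁ k (λ j → F (L ℕ.+ j))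
sum₁-split L zero    F rewrite ℕP.+-identityʳ L = sym (ℤP.+-identityʳ _)
sum₁-split L (suc k) F rewrite ℕP.+-suc L k =
  trans (cong (_+ F (suc (L ℕ.+ k))) (sum₁-split L k F)) (ℤP.+-assoc (sum₁ L F) _ _)

sum₀-cong : ∀ e {G H : ℕ → ℤ} → (∀ i → i ≤ e → G i ≡ H i) → sum₀ e G ≡ sum₀ e H
sum₀-cong zero    G≗H = G≗H 0 z≤n
sum₀-cong (suc e) G≗H = cong₂ _+_ (G≗H 0 z≤n) (sum₀-cong e (λ i i≤e → G≗H (suc i) (s≤s i≤e)))

sum₀-scaleʳ : ∀ e (G : ℕ → ℤ) (y : ℤ) → sum₀ e (λ i → G i * y) ≡ sum₀ e G * y
sum₀-scaleʳ zero    G y = refl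
sum₀-scaleʳ (suc e) G y =
  trans (cong (_+_ (G 0 * y)) (sum₀-scaleʳ e (G ∘ suc) y)) (sym (ℤP.*-distribʳ-+ y (G 0) (sum₀ e (G ∘ suc))))

sum₁-multiples : ∀ p K (H : ℕ → ℤ) → 1 ≤ p →
  sum₁ (K ℕ.* p) (λ d → if does (p ∣? d) then H d else + 0) ≡ sum₁ K (λ j → H (j ℕ.* p))
sum₁-multiples p zero H _ = refl
sum₁-multiples p@(suc p-1) (suc K) H 1≤p = begin
  sum₁ (suc K ℕ.* p) G                                 ≡⟨ cong (λ L → sum₁ L G) (ℕP.+-comm p (K ℕ.* p)) ⟩
  sum₁ (K ℕ.* p ℕ.+ p) G                               ≡⟨ sum₁-split (K ℕ.* p) p G ⟩
  sum₁ (K ℕ.* p) G + sum₁ p (λ j → G (K ℕ.* p ℕ.+ j))  ≡⟨ cong₂ _+_ (sum₁-multiples p K H 1≤p) lastBlock ⟩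
  sum₁ (suc K) (λ j → H (j ℕ.* p))                     ∎
  where
  open ≡-Reasoning
  G : ℕ → ℤ
  G d = if does (p ∣? d) then H d else + 0
  p∤ : ∀ j → 1 ≤ j → j ≤ p-1 → p ∤ (K ℕ.* p ℕ.+ j)
  p∤ j@(suc _) _ j≤p-1 p∣ = ℕP.<⇒≱ (s≤s j≤p-1) (∣⇒≤ (∣m+n∣m⇒∣n p∣ (n∣m*n K)))
  lastBlock : sum₁ p (λ j → G (K ℕ.* p ℕ.+ j)) ≡ H (suc K ℕ.* p)
  lastBlock = begin
    sum₁ p-1 (λ j → G (K ℕ.* p ℕ.+ j)) + G (K ℕ.* p ℕ.+ p)
      ≡⟨ cong₂ _+_ (sum₁-zero p-1 (λ j 1≤j j≤p-1 → if-no (p ∣? _) (p∤ j 1≤j j≤p-1)))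
                   (if-yes (p ∣? _) (subst (p ∣_) (ℕP.+-comm p (K ℕ.* p)) (n∣m*n (suc K)))) ⟩
    + 0 + H (K ℕ.* p ℕ.+ p)  ≡⟨ ℤP.+-identityˡ _ ⟩
    H (K ℕ.* p ℕ.+ p)        ≡⟨ cong H (ℕP.+-comm (K ℕ.* p) p) ⟩
    H (suc K ℕ.* p)          ∎

^-pos : ∀ p i → 1 ≤ p → 1 ≤ p ^ i
^-pos p i 1≤p = ℕP.m^n>0 p {{ℕ.>-nonZero 1≤p}} i

divisor-pos : ∀ {d m} → 1 ≤ m → d ∣ m → 1 ≤ d
divisor-pos {zero}  {suc _} _ (divides q eq) with () ← trans eq (ℕP.*-zeroʳ q)
divisor-pos {suc _}         _ _ = s≤s z≤n

quotient-pos : ∀ {q d m} → 1 ≤ m → m ≡ q ℕ.* d → 1 ≤ q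
quotient-pos {zero}  (s≤s _) ()
quotient-pos {suc _} _       _ = s≤s z≤n

÷-cancel : ∀ X Y → 1 ≤ Y → (X ℕ.* Y) ÷ Y ≡ X
÷-cancel X (suc y) _ = Data.Nat.DivMod.m*n/n≡m X (suc y)

prime≥2 : ∀ {p} → Prime p → 2 ≤ p
prime≥2 {suc (suc _)} _ = s≤s (s≤s z≤n)

prime≥1 : ∀ {p} → Prime p → 1 ≤ p
prime≥1 pp = ℕP.≤-trans (s≤s z≤n) (prime≥2 pp)

coprime-pow-divisor : ∀ {p d m} → Prime p → p ∤ d → ∀ e → d ∣ p ^ e ℕ.* m → d ∣ m
coprime-pow-divisor {p} {d} {m} pp p∤d zero    d∣ = subst (d ∣_) (ℕP.*-identityˡ m) d∣
coprime-pow-divisor {p} {d} {m} pp p∤d (suc e) d∣ =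
  coprime-pow-divisor pp p∤d e (coprime-divisor d⊥p (subst (d ∣_) (ℕP.*-assoc p (p ^ e) m) d∣))
  where
  d⊥p : Coprime d p
  d⊥p (i∣d , i∣p) with prime⇒irreducible pp i∣p
  ... | inj₁ i≡1    = i≡1
  ... | inj₂ refl   = ⊥-elim (p∤d i∣d)

prime∣prime^⇒≡ : ∀ {q p} → Prime q → Prime p → ∀ e → q ∣ p ^ e → q ≡ p
prime∣prime^⇒≡ qq pp zero q∣1 with refl ← ∣1⇒≡1 q∣1 = ⊥-elim (¬prime[1] qq)
prime∣prime^⇒≡ {q} {p} qq pp (suc e) q∣ with euclidsLemma p (p ^ e) qq q∣
... | inj₂ q∣p^e = prime∣prime^⇒≡ qq pp e q∣p^e
... | inj₁ q∣p with prime⇒irreducible pp q∣p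
...   | inj₁ refl = ⊥-elim (¬prime[1] qq)
...   | inj₂ q≡p  = q≡p

-- Divisor sums: Σ_{d ∣ n} F d, written as a sum over 1, …, n.

onDivisors : ℕ → (ℕ → ℤ) → ℕ → ℤ
onDivisors n F d = if does (d ∣? n) then F d else + 0

divSum : ℕ → (ℕ → ℤ) → ℤ
divSum n F = sum₁ n (onDivisors n F)

∗-divSum : ∀ f g n → (f ∗ g) n ≡ divSum n (λ d → f d * g (n ÷ d))
∗-divSum f g n = begin
  (f ∗ g) n                                              ≡⟨ SumFold.fold-filter (_∣? n) H (map suc (upTo n)) ⟩
  sumℤ (map (onDivisors n H) (map suc (upTo n)))         ≡⟨ cong sumℤ (sym (ListP.map-∘ (upTo n))) ⟩
  sumℤ (map (onDivisors n H ∘ suc) (upTo n))             ≡⟨ sum₁-list (onDivisors n H) n ⟩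
  divSum n H                                             ∎
  where
  open ≡-Reasoning
  H : ℕ → ℤ
  H d = f d * g (n ÷ d)

onDivisors-yes : ∀ {n d} (F : ℕ → ℤ) → d ∣ n → onDivisors n F d ≡ F d
onDivisors-yes {n} {d} F = if-yes (d ∣? n)

onDivisors-no : ∀ {n d} (F : ℕ → ℤ) → d ∤ n → onDivisors n F d ≡ + 0
onDivisors-no {n} {d} F = if-no (d ∣? n)

divSum-cong : ∀ n {F G : ℕ → ℤ} → (∀ d → d ∣ n → F d ≡ G d) → divSum n F ≡ divSum n G
divSum-cong n {F} {G} F≗G = sum₁-cong n pointwise
  where
  pointwise : ∀ d → 1 ≤ d → d ≤ n → onDivisors n F d ≡ onDivisors n G d
  pointwise d _ _ with d ∣? n
  ... | yes d∣n = F≗G d d∣n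
  ... | no  _   = refl

divSum-scale : ∀ n (x : ℤ) (F : ℕ → ℤ) → divSum n (λ d → x * F d) ≡ x * divSum n F
divSum-scale n x F = trans (sum₁-cong n pointwise) (sum₁-scale n x (onDivisors n F))
  where
  pointwise : ∀ d → 1 ≤ d → d ≤ n → onDivisors n (λ d → x * F d) d ≡ x * onDivisors n F d
  pointwise d _ _ with d ∣? n
  ... | yes _ = refl
  ... | no  _ = sym (ℤP.*-zeroʳ x)

divSum-extend : ∀ n K (F : ℕ → ℤ) → 1 ≤ n → n ≤ K → sum₁ K (onDivisors n F) ≡ divSum n F
divSum-extend n K F 1≤n n≤K = begin
  sum₁ K (onDivisors n F)                    ≡⟨ cong (λ L → sum₁ L (onDivisors n F)) (sym (ℕP.m+[n∸m]≡n n≤K)) ⟩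
  sum₁ (n ℕ.+ (K ℕ.∸ n)) (onDivisors n F)    ≡⟨ sum₁-split n (K ℕ.∸ n) (onDivisors n F) ⟩
  divSum n F + sum₁ (K ℕ.∸ n) (λ j → onDivisors n F (n ℕ.+ j))
    ≡⟨ cong (_+_ (divSum n F)) (sum₁-zero (K ℕ.∸ n) (λ j 1≤j _ → onDivisors-no F (beyond j 1≤j))) ⟩
  divSum n F + + 0                           ≡⟨ ℤP.+-identityʳ _ ⟩
  divSum n F                                 ∎
  where
  open ≡-Reasoning
  beyond : ∀ j → 1 ≤ j → n ℕ.+ j ∤ n
  beyond j 1≤j = >⇒∤ {{ℕ.>-nonZero 1≤n}} (ℕP.m<m+n n 1≤j)

-- Splitting off one factor p (p ∤ m): a divisor of p N, N = p^e m, is either prime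
-- to p, hence a divisor of m, or of the form p d with d ∣ N.
divSum-step : ∀ p e m (F : ℕ → ℤ) → Prime p → 1 ≤ m → p ∤ m →
  divSum (p ℕ.* (p ^ e ℕ.* m)) F ≡ divSum m F + divSum (p ^ e ℕ.* m) (λ d → F (p ℕ.* d))
divSum-step p e m F pp 1≤m p∤m = begin
  sum₁ pN (onDivisors pN F)                   ≡⟨ sum₁-cong pN (λ d _ _ → splitByP d) ⟩
  sum₁ pN (λ d → onDivisors m F d + multiplesOfP d)
                                              ≡⟨ sum₁-+ pN (onDivisors m F) multiplesOfP ⟩
  sum₁ pN (onDivisors m F) + sum₁ pN multiplesOfP
                                              ≡⟨ cong₂ _+_ (divSum-extend m pN F 1≤m m≤pN) multiplesPart ⟩
  divSum m F + divSum N (λ d → F (p ℕ.* d))   ∎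
  where
  open ≡-Reasoning
  N : ℕ
  N  = p ^ e ℕ.* m
  pN : ℕ
  pN = p ℕ.* N
  pN≡ : pN ≡ p ^ suc e ℕ.* m
  pN≡ = sym (ℕP.*-assoc p (p ^ e) m)
  m≤pN : m ≤ pN
  m≤pN = subst (m ≤_) (sym pN≡) (ℕP.m≤n*m m (p ^ suc e) {{ℕ.>-nonZero (^-pos p (suc e) (prime≥1 pp))}})
  m∣pN : m ∣ pN
  m∣pN = subst (m ∣_) (sym pN≡) (n∣m*n (p ^ suc e))
  multiplesOfP : ℕ → ℤ
  multiplesOfP d = if does (p ∣? d) then onDivisors pN F d else + 0
  splitByP : ∀ d → onDivisors pN F d ≡ onDivisors m F d + multiplesOfP d
  splitByP d with p ∣? d
  ... | yes p∣d = sym (trans (cong (_+ onDivisors pN F d) (onDivisors-no F (λ d∣m → p∤m (∣-trans p∣d d∣m))))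
                             (ℤP.+-identityˡ _))
  ... | no p∤d with d ∣? m
  ...   | yes d∣m = trans (onDivisors-yes F (∣-trans d∣m m∣pN)) (sym (ℤP.+-identityʳ (F d)))
  ...   | no  d∤m = onDivisors-no F (λ d∣pN → d∤m (coprime-pow-divisor pp p∤d (suc e) (subst (d ∣_) pN≡ d∣pN)))
  atMultiple : ∀ j → onDivisors pN F (j ℕ.* p) ≡ onDivisors N (λ d → F (p ℕ.* d)) j
  atMultiple j with j ∣? N
  ... | yes j∣N = trans (onDivisors-yes F (subst (j ℕ.* p ∣_) (ℕP.*-comm N p) (*-monoˡ-∣ p j∣N)))
                        (cong F (ℕP.*-comm j p))
  ... | no  j∤N = onDivisors-no F (λ jp∣pN → j∤N (*-cancelʳ-∣ p {{ℕ.>-nonZero (prime≥1 pp)}}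
                                                     (subst (j ℕ.* p ∣_) (ℕP.*-comm p N) jp∣pN)))
  multiplesPart : sum₁ pN multiplesOfP ≡ divSum N (λ d → F (p ℕ.* d))
  multiplesPart = begin
    sum₁ pN multiplesOfP               ≡⟨ cong (λ L → sum₁ L multiplesOfP) (ℕP.*-comm p N) ⟩
    sum₁ (N ℕ.* p) multiplesOfP        ≡⟨ sum₁-multiples p N (onDivisors pN F) (prime≥1 pp) ⟩
    sum₁ N (λ j → onDivisors pN F (j ℕ.* p))
                                       ≡⟨ sum₁-cong N (λ j _ _ → atMultiple j) ⟩
    divSum N (λ d → F (p ℕ.* d))       ∎

divSum-primePower : ∀ p e m (F : ℕ → ℤ) → Prime p → 1 ≤ m → p ∤ m →
  divSum (p ^ e ℕ.* m) F ≡ sum₀ e (λ i → divSum m (λ d → F (p ^ i ℕ.* d)))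
divSum-primePower p zero m F pp 1≤m p∤m rewrite ℕP.*-identityˡ m =
  divSum-cong m (λ d _ → cong F (sym (ℕP.*-identityˡ d)))
divSum-primePower p (suc e) m F pp 1≤m p∤m = begin
  divSum (p ^ suc e ℕ.* m) F                          ≡⟨ cong (λ n → divSum n F) (ℕP.*-assoc p (p ^ e) m) ⟩
  divSum (p ℕ.* (p ^ e ℕ.* m)) F                      ≡⟨ divSum-step p e m F pp 1≤m p∤m ⟩
  divSum m F + divSum (p ^ e ℕ.* m) (λ d → F (p ℕ.* d))
    ≡⟨ cong₂ _+_ (divSum-cong m (λ d _ → cong F (sym (ℕP.*-identityˡ d))))
                 (trans (divSum-primePower p e m (λ d → F (p ℕ.* d)) pp 1≤m p∤m)
                        (sum₀-cong e (λ i _ → divSum-cong m (λ d _ → cong F (sym (ℕP.*-assoc p (p ^ i) d)))))) ⟩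
  sum₀ (suc e) (λ i → divSum m (λ d → F (p ^ i ℕ.* d)))  ∎
  where open ≡-Reasoning

MultiplicativeAt : ℕ → (ℕ → ℤ) → (ℕ → ℤ) → Set
MultiplicativeAt p F f = ∀ i d → 1 ≤ d → p ∤ d → f (p ^ i ℕ.* d) ≡ F i * f d

_⋆_ : (ℕ → ℤ) → (ℕ → ℤ) → ℕ → ℤ
(F ⋆ G) e = sum₀ e (λ i → F i * G (e ℕ.∸ i))

split-pow : ∀ p e i q d → i ≤ e → p ^ e ℕ.* (q ℕ.* d) ≡ (p ^ (e ℕ.∸ i) ℕ.* q) ℕ.* (p ^ i ℕ.* d)
split-pow p e i q d i≤e = begin
  p ^ e ℕ.* (q ℕ.* d)                           ≡⟨ cong (λ k → p ^ k ℕ.* (q ℕ.* d)) (sym (ℕP.m∸n+n≡m i≤e)) ⟩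
  p ^ (e ℕ.∸ i ℕ.+ i) ℕ.* (q ℕ.* d)             ≡⟨ cong (ℕ._* (q ℕ.* d)) (ℕP.^-distribˡ-+-* p (e ℕ.∸ i) i) ⟩
  (p ^ (e ℕ.∸ i) ℕ.* p ^ i) ℕ.* (q ℕ.* d)       ≡⟨ ℕ*.interchange (p ^ (e ℕ.∸ i)) (p ^ i) q d ⟩
  (p ^ (e ℕ.∸ i) ℕ.* q) ℕ.* (p ^ i ℕ.* d)       ∎
  where open ≡-Reasoning

-- The convolution of functions multiplicative at p is multiplicative at p, with
-- the convolution of the local factors: every divisor of p^e m is p^i d with d ∣ m.
∗-multiplicativeAt : ∀ p {F G f g} → Prime p →
  MultiplicativeAt p F f → MultiplicativeAt p G g → MultiplicativeAt p (F ⋆ G) (f ∗ g)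
∗-multiplicativeAt p {F} {G} {f} {g} pp f-mult g-mult e m 1≤m p∤m = begin
  (f ∗ g) n                                             ≡⟨ ∗-divSum f g n ⟩
  divSum n H                                            ≡⟨ divSum-primePower p e m H pp 1≤m p∤m ⟩
  sum₀ e (λ i → divSum m (λ d → H (p ^ i ℕ.* d)))
    ≡⟨ sum₀-cong e (λ i i≤e → trans (divSum-cong m (λ d d∣m → term i d i≤e d∣m))
                                    (divSum-scale m (F i * G (e ℕ.∸ i)) K)) ⟩
  sum₀ e (λ i → (F i * G (e ℕ.∸ i)) * divSum m K)      ≡⟨ sum₀-scaleʳ e (λ i → F i * G (e ℕ.∸ i)) (divSum m K) ⟩
  (F ⋆ G) e * divSum m K                                ≡⟨ cong ((F ⋆ G) e *_) (sym (∗-divSum f g m)) ⟩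
  (F ⋆ G) e * (f ∗ g) m                                 ∎
  where
  open ≡-Reasoning
  n : ℕ
  n = p ^ e ℕ.* m
  H K : ℕ → ℤ
  H d = f d * g (n ÷ d)
  K d = f d * g (m ÷ d)
  term : ∀ i d → i ≤ e → d ∣ m → H (p ^ i ℕ.* d) ≡ (F i * G (e ℕ.∸ i)) * K d
  term i d i≤e d∣m@(divides q m≡qd) = begin
    f (p ^ i ℕ.* d) * g (n ÷ (p ^ i ℕ.* d))      ≡⟨ cong₂ _*_ (f-mult i d 1≤d p∤d) (cong g n/p^id) ⟩
    (F i * f d) * g (p ^ (e ℕ.∸ i) ℕ.* q)        ≡⟨ cong ((F i * f d) *_) (g-mult (e ℕ.∸ i) q 1≤q p∤q) ⟩
    (F i * f d) * (G (e ℕ.∸ i) * g q)            ≡⟨ cong (λ k → (F i * f d) * (G (e ℕ.∸ i) * g k)) (sym m/d) ⟩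
    (F i * f d) * (G (e ℕ.∸ i) * g (m ÷ d))      ≡⟨ ℤ*.interchange (F i) (f d) (G (e ℕ.∸ i)) (g (m ÷ d)) ⟩
    (F i * G (e ℕ.∸ i)) * K d                    ∎
    where
    1≤d : 1 ≤ d
    1≤d = divisor-pos 1≤m d∣m
    1≤q : 1 ≤ q
    1≤q = quotient-pos 1≤m m≡qd
    p∤d : p ∤ d
    p∤d p∣d = p∤m (∣-trans p∣d d∣m)
    p∤q : p ∤ q
    p∤q p∣q = p∤m (∣-trans p∣q (divides d (trans m≡qd (ℕP.*-comm q d))))
    m/d : m ÷ d ≡ q
    m/d = trans (cong (_÷ d) m≡qd) (÷-cancel q d 1≤d)
    n/p^id : n ÷ (p ^ i ℕ.* d) ≡ p ^ (e ℕ.∸ i) ℕ.* q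
    n/p^id = trans (cong (λ k → (p ^ e ℕ.* k) ÷ (p ^ i ℕ.* d)) m≡qd)
                   (trans (cong (_÷ (p ^ i ℕ.* d)) (split-pow p e i q d i≤e))
                          (÷-cancel _ _ (ℕP.*-mono-≤ (^-pos p i (prime≥1 pp)) 1≤d)))

^-suc-* : ∀ q e x → q ^ suc e ℕ.* x ≡ (q ^ e ℕ.* x) ℕ.* q
^-suc-* q e x = trans (ℕP.*-assoc q (q ^ e) x) (ℕP.*-comm q (q ^ e ℕ.* x))

record PrimePowerSplit (p n : ℕ) : Set where
  constructor splitAs
  field
    exponent cofactor : ℕ
    n≡ : n ≡ p ^ exponent ℕ.* cofactor
    cofactor-pos : 1 ≤ cofactor
    p∤cofactor : p ∤ cofactor

splitOff : ∀ {p} → 2 ≤ p → ∀ n → 1 ≤ n → PrimePowerSplit p n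
splitOff {p} 2≤p = <-rec (λ n → 1 ≤ n → PrimePowerSplit p n) step
  where
  step : ∀ n → (∀ {k} → k < n → 1 ≤ k → PrimePowerSplit p k) → 1 ≤ n → PrimePowerSplit p n
  step n rec 1≤n with p ∣? n
  ... | no  p∤n = splitAs 0 n (sym (ℕP.*-identityˡ n)) 1≤n p∤n
  ... | yes (divides k n≡kp) = extend (rec k<n 1≤k)
    where
    1≤k : 1 ≤ k
    1≤k = quotient-pos 1≤n n≡kp
    k<n : k < n
    k<n = subst (k <_) (sym n≡kp) (ℕP.m<m*n k p {{ℕ.>-nonZero 1≤k}} 2≤p)
    extend : PrimePowerSplit p k → PrimePowerSplit p n
    extend (splitAs e m k≡ 1≤m p∤m) =
      splitAs (suc e) m (trans n≡kp (trans (cong (ℕ._* p) k≡) (sym (^-suc-* p e m)))) 1≤m p∤m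

record PrimePowerPart (n : ℕ) : Set where
  constructor primePowerPart
  field
    p e m : ℕ
    p-prime : Prime p
    n≡ : n ≡ p ^ suc e ℕ.* m
    m-pos : 1 ≤ m
    p∤m : p ∤ m

-- Take any prime factor of n; its exponent in n is positive.
primePowerPart-of : ∀ n → 2 ≤ n → PrimePowerPart n
primePowerPart-of (suc zero) (s≤s ())
primePowerPart-of n@(suc (suc _)) _ with factorise n
... | record { factors = [] ; isFactorisation = () }
... | record { factors = p ∷ ps ; isFactorisation = n≡∏ ; factorsPrime = pp ∷ _ }
  with splitOff (prime≥2 pp) n (s≤s z≤n)
...   | splitAs zero    m n≡ _   p∤m = ⊥-elim (p∤m (subst (p ∣_) (trans (sym n≡∏) (trans n≡ (ℕP.*-identityˡ m)))
                                                               (m∣m*n (product ps))))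
...   | splitAs (suc e) m n≡ 1≤m p∤m = primePowerPart p e m pp n≡ 1≤m p∤m

agree-by-local-factors : ∀ (f g : ℕ → ℤ) (F : ℕ → ℕ → ℤ) → f 1 ≡ g 1 →
  (∀ p → Prime p → MultiplicativeAt p (F p) f) → (∀ p → Prime p → MultiplicativeAt p (F p) g) →
  ∀ n → 1 ≤ n → f n ≡ g n
agree-by-local-factors f g F f1≡g1 f-mult g-mult = <-rec (λ n → 1 ≤ n → f n ≡ g n) step
  where
  step : ∀ n → (∀ {k} → k < n → 1 ≤ k → f k ≡ g k) → 1 ≤ n → f n ≡ g n
  step (suc zero)        _   _ = f1≡g1
  step n@(suc (suc _))   rec _ with primePowerPart-of n (s≤s (s≤s z≤n))
  ... | primePowerPart p e m pp n≡ 1≤m p∤m = begin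
    f n                       ≡⟨ cong f n≡ ⟩
    f (p ^ suc e ℕ.* m)       ≡⟨ f-mult p pp (suc e) m 1≤m p∤m ⟩
    F p (suc e) * f m         ≡⟨ cong (F p (suc e) *_) (rec m<n 1≤m) ⟩
    F p (suc e) * g m         ≡⟨ sym (g-mult p pp (suc e) m 1≤m p∤m) ⟩
    g (p ^ suc e ℕ.* m)       ≡⟨ cong g (sym n≡) ⟩
    g n                       ∎
    where
    open ≡-Reasoning
    2≤p^e+1 : 2 ≤ p ^ suc e
    2≤p^e+1 = ℕP.≤-trans (prime≥2 pp) (ℕP.m≤m*n p (p ^ e) {{ℕ.>-nonZero (^-pos p e (prime≥1 pp))}})
    m<n : m < n
    m<n = subst (m <_) (trans (ℕP.*-comm m (p ^ suc e)) (sym n≡)) (ℕP.m<m*n m (p ^ suc e) {{ℕ.>-nonZero 1≤m}} 2≤p^e+1)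

-- e < q^e, so n = q^e x is enough fuel for the valuation
exponent<power : ∀ q e → 2 ≤ q → e < q ^ e
exponent<power q zero    _   = s≤s z≤n
exponent<power q (suc e) 2≤q = begin-strict
  suc e                 <⟨ s≤s (exponent<power q e 2≤q) ⟩
  1 ℕ.+ q ^ e           ≤⟨ ℕP.+-monoˡ-≤ (q ^ e) (^-pos q e (ℕP.≤-trans (s≤s z≤n) 2≤q)) ⟩
  q ^ e ℕ.+ q ^ e       ≡⟨ cong (q ^ e ℕ.+_) (sym (ℕP.+-identityʳ (q ^ e))) ⟩
  2 ℕ.* q ^ e           ≤⟨ ℕP.*-monoˡ-≤ (q ^ e) 2≤q ⟩
  q ^ suc e             ∎
  where open ℕP.≤-Reasoning

vAux-pow : ∀ q x → 2 ≤ q → 1 ≤ x → q ∤ x → ∀ e k → e ≤ k → vAux k q (q ^ e ℕ.* x) ≡ e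
vAux-pow q x 2≤q 1≤x q∤x zero zero _ = refl
vAux-pow q x 2≤q 1≤x q∤x zero (suc k) _
  rewrite ℕP.*-identityˡ x | dec-true (2 ℕ.≤? q) 2≤q | dec-true (1 ℕ.≤? x) 1≤x | dec-false (q ∣? x) q∤x = refl
vAux-pow q x 2≤q 1≤x q∤x (suc e) (suc k) (s≤s e≤k)
  rewrite dec-true (2 ℕ.≤? q) 2≤q
        | dec-true (1 ℕ.≤? (q ^ suc e ℕ.* x)) (ℕP.*-mono-≤ (^-pos q (suc e) (ℕP.≤-trans (s≤s z≤n) 2≤q)) 1≤x)
        | dec-true (q ∣? (q ^ suc e ℕ.* x)) (divides (q ^ e ℕ.* x) (^-suc-* q e x))
  = cong suc (trans (cong (vAux k q) (trans (cong (_÷ q) (^-suc-* q e x)) (÷-cancel _ q 1≤q)))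
                    (vAux-pow q x 2≤q 1≤x q∤x e k e≤k))
  where
  1≤q : 1 ≤ q
  1≤q = ℕP.≤-trans (s≤s z≤n) 2≤q

val-pow : ∀ q x e → 2 ≤ q → 1 ≤ x → q ∤ x → val q (q ^ e ℕ.* x) ≡ e
val-pow q x e 2≤q 1≤x q∤x = vAux-pow q x 2≤q 1≤x q∤x e (q ^ e ℕ.* x)
  (ℕP.≤-trans (ℕP.<⇒≤ (exponent<power q e 2≤q)) (ℕP.m≤m*n (q ^ e) x {{ℕ.>-nonZero 1≤x}}))

val-coprime : ∀ q x → 2 ≤ q → 1 ≤ x → q ∤ x → val q x ≡ 0
val-coprime q x 2≤q 1≤x q∤x = subst (λ y → val q y ≡ 0) (ℕP.*-identityˡ x) (val-pow q x 0 2≤q 1≤x q∤x)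

val-other : ∀ p q e m → Prime p → Prime q → q ≢ p → 1 ≤ m → val q (p ^ e ℕ.* m) ≡ val q m
val-other p q e m pp qq q≢p 1≤m with splitOff (prime≥2 qq) m 1≤m
... | splitAs f x m≡ 1≤x q∤x = begin
  val q (p ^ e ℕ.* m)              ≡⟨ cong (val q) p^em≡ ⟩
  val q (q ^ f ℕ.* (p ^ e ℕ.* x))  ≡⟨ val-pow q (p ^ e ℕ.* x) f (prime≥2 qq) 1≤p^ex q∤p^ex ⟩
  f                                ≡⟨ sym (val-pow q x f (prime≥2 qq) 1≤x q∤x) ⟩
  val q (q ^ f ℕ.* x)              ≡⟨ cong (val q) (sym m≡) ⟩
  val q m                          ∎
  where
  open ≡-Reasoning
  p^em≡ : p ^ e ℕ.* m ≡ q ^ f ℕ.* (p ^ e ℕ.* x)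
  p^em≡ = trans (cong (p ^ e ℕ.*_) m≡) (ℕ*.x∙yz≈y∙xz (p ^ e) (q ^ f) x)
  1≤p^ex : 1 ≤ p ^ e ℕ.* x
  1≤p^ex = ℕP.*-mono-≤ (^-pos p e (prime≥1 pp)) 1≤x
  q∤p^ex : q ∤ p ^ e ℕ.* x
  q∤p^ex q∣ with euclidsLemma (p ^ e) x qq q∣
  ... | inj₁ q∣p^e = q≢p (prime∣prime^⇒≡ qq pp e q∣p^e)
  ... | inj₂ q∣x   = q∤x q∣x

prod₀-cong : ∀ K {F G : ℕ → ℤ} → (∀ q → q < K → F q ≡ G q) → prod₀ K F ≡ prod₀ K G
prod₀-cong zero    F≗G = refl
prod₀-cong (suc K) F≗G = cong₂ _*_ (prod₀-cong K (λ q q<K → F≗G q (ℕP.m≤n⇒m≤1+n q<K))) (F≗G K ℕP.≤-refl)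

prod₀-extend : ∀ K t (F : ℕ → ℤ) → (∀ q → K ≤ q → q < K ℕ.+ t → F q ≡ + 1) →
  prod₀ (K ℕ.+ t) F ≡ prod₀ K F
prod₀-extend K zero    F ones rewrite ℕP.+-identityʳ K = refl
prod₀-extend K (suc t) F ones rewrite ℕP.+-suc K t =
  trans (cong₂ _*_ (prod₀-extend K t F (λ q K≤q q<K+t → ones q K≤q (ℕP.m≤n⇒m≤1+n q<K+t)))
                   (ones (K ℕ.+ t) (ℕP.m≤m+n K t) ℕP.≤-refl))
        (ℤP.*-identityʳ _)

prod₀-pick : ∀ K p (F G : ℕ → ℤ) → p < K → (∀ q → q < K → q ≢ p → F q ≡ G q) → G p ≡ + 1 →
  prod₀ K F ≡ F p * prod₀ K G
prod₀-pick (suc K) p F G p<1+K F≗G Gp≡1 with p ℕ.≟ K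
... | yes refl = begin
  prod₀ K F * F K          ≡⟨ cong (_* F K) (prod₀-cong K (λ q q<K → F≗G q (ℕP.m≤n⇒m≤1+n q<K) (ℕP.<⇒≢ q<K))) ⟩
  prod₀ K G * F K          ≡⟨ ℤP.*-comm (prod₀ K G) (F K) ⟩
  F K * prod₀ K G          ≡⟨ cong (F K *_) (sym (trans (cong (prod₀ K G *_) Gp≡1) (ℤP.*-identityʳ _))) ⟩
  F K * (prod₀ K G * G K)  ∎
  where open ≡-Reasoning
... | no p≢K = begin
  prod₀ K F * F K          ≡⟨ cong₂ _*_ (prod₀-pick K p F G (ℕP.≤∧≢⇒< (ℕP.≤-pred p<1+K) p≢K)
                                                    (λ q q<K → F≗G q (ℕP.m≤n⇒m≤1+n q<K)) Gp≡1)
                                        (F≗G K ℕP.≤-refl (p≢K ∘ sym)) ⟩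
  (F p * prod₀ K G) * G K  ≡⟨ ℤP.*-assoc (F p) _ _ ⟩
  F p * (prod₀ K G * G K)  ∎
  where open ≡-Reasoning

bFactor : ℕ → ℕ → ℕ → ℤ
bFactor r n q = if does (prime? q) then bpp r q (val q n) else + 1

b-prod₀ : ∀ r n → b r n ≡ prod₀ (suc n) (bFactor r n)
b-prod₀ r n = trans (ProdFold.fold-filter prime? (λ q → bpp r q (val q n)) (upTo (suc n)))
                    (prod₀-list (bFactor r n) (suc n))

-- b_r(p^i m) = b_r(p^i) b_r(m): the factors of b_r(p^i m) and b_r(m) agree away from p
-- and beyond m (where they are 1), while at p they are b_r(p^i) and 1.
b-multiplicativeAt : ∀ r p → Prime p → MultiplicativeAt p (bpp r p) (b r)
b-multiplicativeAt r p pp zero m 1≤m p∤m rewrite ℕP.*-identityˡ m = sym (ℤP.*-identityˡ (b r m))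
b-multiplicativeAt r p pp (suc e) m 1≤m p∤m = begin
  b r n                                  ≡⟨ b-prod₀ r n ⟩
  prod₀ (suc n) (bFactor r n)            ≡⟨ prod₀-pick (suc n) p (bFactor r n) (bFactor r m) (s≤s p≤n) sameAway
                                                       (trans (if-yes (prime? p) pp) (cong (bpp r p) (val-coprime p m 2≤p 1≤m p∤m))) ⟩
  bFactor r n p * prod₀ (suc n) (bFactor r m)
    ≡⟨ cong₂ _*_ (trans (if-yes (prime? p) pp) (cong (bpp r p) (val-pow p m (suc e) 2≤p 1≤m p∤m)))
                 (trans (cong (λ K → prod₀ K (bFactor r m)) (sym (ℕP.m+[n∸m]≡n (s≤s m≤n))))
                        (prod₀-extend (suc m) (suc n ℕ.∸ suc m) (bFactor r m) onesBeyond)) ⟩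
  bpp r p (suc e) * prod₀ (suc m) (bFactor r m)  ≡⟨ cong (bpp r p (suc e) *_) (sym (b-prod₀ r m)) ⟩
  bpp r p (suc e) * b r m                        ∎
  where
  open ≡-Reasoning
  n : ℕ
  n   = p ^ suc e ℕ.* m
  2≤p : 2 ≤ p
  2≤p = prime≥2 pp
  m≤n : m ≤ n
  m≤n = ℕP.m≤n*m m (p ^ suc e) {{ℕ.>-nonZero (^-pos p (suc e) (prime≥1 pp))}}
  p≤n : p ≤ n
  p≤n = ℕP.≤-trans (ℕP.m≤m*n p (p ^ e) {{ℕ.>-nonZero (^-pos p e (prime≥1 pp))}})
                   (ℕP.m≤m*n (p ^ suc e) m {{ℕ.>-nonZero 1≤m}})
  sameAway : ∀ q → q < suc n → q ≢ p → bFactor r n q ≡ bFactor r m q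
  sameAway q _ q≢p with prime? q
  ... | yes qq = cong (bpp r q) (val-other p q (suc e) m pp qq q≢p 1≤m)
  ... | no  _  = refl
  onesBeyond : ∀ q → suc m ≤ q → q < suc m ℕ.+ (suc n ℕ.∸ suc m) → bFactor r m q ≡ + 1
  onesBeyond q m<q _ with prime? q
  ... | yes qq = cong (bpp r q) (val-coprime q m (prime≥2 qq) 1≤m (>⇒∤ {{ℕ.>-nonZero 1≤m}} m<q))
  ... | no  _  = refl

prodℕ-shift : ∀ e (f : ℕ → ℕ) → prodℕ (suc e) f ≡ f 0 ℕ.* prodℕ e (f ∘ suc)
prodℕ-shift zero    f = ℕP.*-comm 1 (f 0)
prodℕ-shift (suc e) f = trans (cong (ℕ._* f (suc e)) (prodℕ-shift e f)) (ℕP.*-assoc (f 0) _ _)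

prodℕ-cong : ∀ e {f g : ℕ → ℕ} → (∀ i → i < e → f i ≡ g i) → prodℕ e f ≡ prodℕ e g
prodℕ-cong zero    f≗g = refl
prodℕ-cong (suc e) f≗g = cong₂ ℕ._*_ (prodℕ-cong e (λ i i<e → f≗g i (ℕP.m≤n⇒m≤1+n i<e))) (f≗g e ℕP.≤-refl)

prodℕ-scale : ∀ e x (f : ℕ → ℕ) → prodℕ e (λ i → x ℕ.* f i) ≡ x ^ e ℕ.* prodℕ e f
prodℕ-scale zero    x f = refl
prodℕ-scale (suc e) x f = trans (cong (ℕ._* (x ℕ.* f e)) (prodℕ-scale e x f)) (regroup (x ^ e) (prodℕ e f) x (f e))
  where
  regroup : ∀ w y z u → (w ℕ.* y) ℕ.* (z ℕ.* u) ≡ (z ℕ.* w) ℕ.* (y ℕ.* u)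
  regroup = ℕSolver.solve-∀

prodℕ-pos : ∀ e (f : ℕ → ℕ) → (∀ i → i < e → 1 ≤ f i) → 1 ≤ prodℕ e f
prodℕ-pos zero    f pos = s≤s z≤n
prodℕ-pos (suc e) f pos = ℕP.*-mono-≤ (prodℕ-pos e f (λ i i<e → pos i (ℕP.m≤n⇒m≤1+n i<e))) (pos e ℕP.≤-refl)

-- Fix p ≥ 2.  The quotient defining (r choose e)_p is exact and equals the Gaussian
-- binomial given by the q-Pascal recursion; this yields the recursion for b_r(p^e).
module GaussianBinomial (p : ℕ) (2≤p : 2 ≤ p) where

  -- numerator of (r choose e)_p: Π_{i<e} (p^r - p^i); the denominator is numerator e e
  numerator : ℕ → ℕ → ℕ
  numerator r e = prodℕ e (λ i → p ^ r ℕ.∸ p ^ i)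

  gauss : ℕ → ℕ → ℕ
  gauss r       zero    = 1
  gauss zero    (suc e) = 0
  gauss (suc r) (suc e) = p ^ suc e ℕ.* gauss r (suc e) ℕ.+ gauss r e

  1≤p : 1 ≤ p
  1≤p = ℕP.≤-trans (s≤s z≤n) 2≤p

  -- factoring p^(r+1) - 1 out of the first factor and p out of the others
  numerator-step : ∀ r e → numerator (suc r) (suc e) ≡ (p ^ suc r ℕ.∸ 1) ℕ.* (p ^ e ℕ.* numerator r e)
  numerator-step r e = trans (prodℕ-shift e (λ i → p ^ suc r ℕ.∸ p ^ i))
    (cong ((p ^ suc r ℕ.∸ 1) ℕ.*_)
          (trans (prodℕ-cong e (λ i _ → sym (ℕP.*-distribˡ-∸ p (p ^ r) (p ^ i))))
                 (prodℕ-scale e p (λ i → p ^ r ℕ.∸ p ^ i))))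

  -- for r < e the factor p^r - p^r occurs
  numerator-vanish : ∀ r e → r < e → numerator r e ≡ 0
  numerator-vanish r (suc e) r<1+e with r ℕ.≟ e
  ... | yes refl = trans (cong (numerator r e ℕ.*_) (ℕP.n∸n≡0 (p ^ r))) (ℕP.*-zeroʳ (numerator r e))
  ... | no  r≢e  = cong (ℕ._* (p ^ r ℕ.∸ p ^ e)) (numerator-vanish r e (ℕP.≤∧≢⇒< (ℕP.≤-pred r<1+e) r≢e))

  -- the q-Pascal rule at the level of numerators, from p^(r+1) - 1 = p (p^r - p^e) + (p^(e+1) - 1)
  numerator-pascal : ∀ r e → numerator (suc r) (suc e)
    ≡ p ^ suc e ℕ.* numerator r (suc e) ℕ.+ (p ^ suc e ℕ.∸ 1) ℕ.* (p ^ e ℕ.* numerator r e)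
  numerator-pascal r e with e ℕ.≤? r
  ... | yes e≤r = begin
    numerator (suc r) (suc e)                                ≡⟨ numerator-step r e ⟩
    (p ^ suc r ℕ.∸ 1) ℕ.* X                                  ≡⟨ cong (ℕ._* X) split-1 ⟩
    (p ℕ.* (p ^ r ℕ.∸ p ^ e) ℕ.+ (p ^ suc e ℕ.∸ 1)) ℕ.* X
      ≡⟨ regroup p (p ^ e) (p ^ r ℕ.∸ p ^ e) (p ^ suc e ℕ.∸ 1) (numerator r e) ⟩
    p ^ suc e ℕ.* (numerator r e ℕ.* (p ^ r ℕ.∸ p ^ e)) ℕ.+ (p ^ suc e ℕ.∸ 1) ℕ.* X  ∎
    where
    open ≡-Reasoning
    X : ℕ
    X = p ^ e ℕ.* numerator r e
    split-1 : p ^ suc r ℕ.∸ 1 ≡ p ℕ.* (p ^ r ℕ.∸ p ^ e) ℕ.+ (p ^ suc e ℕ.∸ 1)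
    split-1 = begin
      p ^ suc r ℕ.∸ 1
        ≡⟨ cong (ℕ._∸ 1) (sym (ℕP.m∸n+n≡m (ℕP.^-monoʳ-≤ p {{ℕ.>-nonZero 1≤p}} (s≤s e≤r)))) ⟩
      (p ^ suc r ℕ.∸ p ^ suc e ℕ.+ p ^ suc e) ℕ.∸ 1
        ≡⟨ ℕP.+-∸-assoc (p ^ suc r ℕ.∸ p ^ suc e) (^-pos p (suc e) 1≤p) ⟩
      (p ^ suc r ℕ.∸ p ^ suc e) ℕ.+ (p ^ suc e ℕ.∸ 1)
        ≡⟨ cong (ℕ._+ (p ^ suc e ℕ.∸ 1)) (sym (ℕP.*-distribˡ-∸ p (p ^ r) (p ^ e))) ⟩
      p ℕ.* (p ^ r ℕ.∸ p ^ e) ℕ.+ (p ^ suc e ℕ.∸ 1)  ∎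
    regroup : ∀ x y z w v → (x ℕ.* z ℕ.+ w) ℕ.* (y ℕ.* v) ≡ (x ℕ.* y) ℕ.* (v ℕ.* z) ℕ.+ w ℕ.* (y ℕ.* v)
    regroup = ℕSolver.solve-∀
  ... | no e≰r = begin
    numerator (suc r) (suc e)                                ≡⟨ numerator-vanish (suc r) (suc e) (s≤s r<e) ⟩
    0                                                        ≡⟨ zeros (p ^ suc e) (p ^ suc e ℕ.∸ 1) (p ^ e) ⟩
    p ^ suc e ℕ.* 0 ℕ.+ (p ^ suc e ℕ.∸ 1) ℕ.* (p ^ e ℕ.* 0)
      ≡⟨ sym (cong₂ (λ x y → p ^ suc e ℕ.* x ℕ.+ (p ^ suc e ℕ.∸ 1) ℕ.* (p ^ e ℕ.* y))
                    (numerator-vanish r (suc e) (ℕP.m≤n⇒m≤1+n r<e)) (numerator-vanish r e r<e)) ⟩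
    p ^ suc e ℕ.* numerator r (suc e) ℕ.+ (p ^ suc e ℕ.∸ 1) ℕ.* (p ^ e ℕ.* numerator r e)  ∎
    where
    open ≡-Reasoning
    r<e : r < e
    r<e = ℕP.≰⇒> e≰r
    zeros : ∀ x y z → 0 ≡ x ℕ.* 0 ℕ.+ y ℕ.* (z ℕ.* 0)
    zeros = ℕSolver.solve-∀

  numerator≡gauss* : ∀ r e → numerator r e ≡ gauss r e ℕ.* numerator e e
  numerator≡gauss* r       zero    = refl
  numerator≡gauss* zero    (suc e) =
    trans (cong (numerator zero e ℕ.*_) (ℕP.m≤n⇒m∸n≡0 (^-pos p e 1≤p))) (ℕP.*-zeroʳ (numerator zero e))
  numerator≡gauss* (suc r) (suc e) = begin
    numerator (suc r) (suc e)                                         ≡⟨ numerator-pascal r e ⟩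
    p ^ suc e ℕ.* numerator r (suc e) ℕ.+ u ℕ.* (q ℕ.* numerator r e)
      ≡⟨ cong₂ (λ x y → p ^ suc e ℕ.* x ℕ.+ u ℕ.* (q ℕ.* y)) (numerator≡gauss* r (suc e)) (numerator≡gauss* r e) ⟩
    p ^ suc e ℕ.* (gauss r (suc e) ℕ.* D') ℕ.+ u ℕ.* (q ℕ.* (gauss r e ℕ.* D))
      ≡⟨ cong (λ x → p ^ suc e ℕ.* (gauss r (suc e) ℕ.* x) ℕ.+ u ℕ.* (q ℕ.* (gauss r e ℕ.* D))) (numerator-step e e) ⟩
    p ^ suc e ℕ.* (gauss r (suc e) ℕ.* (u ℕ.* (q ℕ.* D))) ℕ.+ u ℕ.* (q ℕ.* (gauss r e ℕ.* D))
      ≡⟨ regroup (p ^ suc e) (gauss r (suc e)) u q D (gauss r e) ⟩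
    gauss (suc r) (suc e) ℕ.* (u ℕ.* (q ℕ.* D))
      ≡⟨ cong (gauss (suc r) (suc e) ℕ.*_) (sym (numerator-step e e)) ⟩
    gauss (suc r) (suc e) ℕ.* D'                                      ∎
    where
    open ≡-Reasoning
    u q D D' : ℕ
    u  = p ^ suc e ℕ.∸ 1
    q  = p ^ e
    D  = numerator e e
    D' = numerator (suc e) (suc e)
    regroup : ∀ P g u q d h → P ℕ.* (g ℕ.* (u ℕ.* (q ℕ.* d))) ℕ.+ u ℕ.* (q ℕ.* (h ℕ.* d))
                              ≡ (P ℕ.* g ℕ.+ h) ℕ.* (u ℕ.* (q ℕ.* d))
    regroup = ℕSolver.solve-∀

  pbinom≡gauss : ∀ r e → pbinom p r e ≡ gauss r e
  pbinom≡gauss r e = trans (cong (_÷ numerator e e) (numerator≡gauss* r e)) (÷-cancel (gauss r e) (numerator e e) denominator-pos)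
    where
    denominator-pos : 1 ≤ numerator e e
    denominator-pos = prodℕ-pos e _ (λ i i<e → ℕP.m<n⇒0<n∸m (ℕP.^-monoʳ-< p 2≤p i<e))

  bpp-gauss : ∀ r e → bpp r p e ≡ sgn e * (+ (p ^ (e C 2)) * + gauss r e)
  bpp-gauss r e = cong (sgn e *_) (trans (cong (λ g → + (p ^ (e C 2) ℕ.* g)) (pbinom≡gauss r e)) (ℤP.pos-* (p ^ (e C 2)) (gauss r e)))

  pow-C2-step : ∀ e → + (p ^ (suc e C 2)) ≡ + (p ^ (e C 2)) * + (p ^ e)
  pow-C2-step e = begin
    + (p ^ (suc e C 2))             ≡⟨ cong (λ k → + (p ^ k)) C2-step ⟩
    + (p ^ (e C 2 ℕ.+ e))           ≡⟨ cong +_ (ℕP.^-distribˡ-+-* p (e C 2) e) ⟩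
    + (p ^ (e C 2) ℕ.* p ^ e)       ≡⟨ ℤP.pos-* (p ^ (e C 2)) (p ^ e) ⟩
    + (p ^ (e C 2)) * + (p ^ e)     ∎
    where
    open ≡-Reasoning
    C2-step : suc e C 2 ≡ e C 2 ℕ.+ e
    C2-step = trans (sym (nCk+nC[k+1]≡[n+1]C[k+1] e 1)) (trans (cong (ℕ._+ e C 2) (nC1≡n e)) (ℕP.+-comm e (e C 2)))

  bpp-pascal : ∀ r e → bpp (suc r) p (suc e) ≡ + (p ^ suc e) * bpp r p (suc e) - + (p ^ e) * bpp r p e
  bpp-pascal r e = begin
    bpp (suc r) p (suc e)
      ≡⟨ bpp-gauss (suc r) (suc e) ⟩
    sgn (suc e) * (+ (p ^ (suc e C 2)) * + (p ^ suc e ℕ.* g₁ ℕ.+ g₀))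
      ≡⟨ cong₂ (λ x y → x * (y * + (p ^ suc e ℕ.* g₁ ℕ.+ g₀))) (ℤP.-1*i≡-i s) (pow-C2-step e) ⟩
    - s * ((κ * Q) * + (p ^ suc e ℕ.* g₁ ℕ.+ g₀))
      ≡⟨ cong (λ x → - s * ((κ * Q) * x))
              (trans (ℤP.pos-+ (p ^ suc e ℕ.* g₁) g₀) (cong (_+ + g₀) (ℤP.pos-* (p ^ suc e) g₁))) ⟩
    - s * ((κ * Q) * (P * + g₁ + + g₀))
      ≡⟨ expand s κ Q P (+ g₁) (+ g₀) ⟩
    P * (- s * ((κ * Q) * + g₁)) - Q * (s * (κ * + g₀))
      ≡⟨ cong₂ (λ x y → P * (x * (y * + g₁)) - Q * (s * (κ * + g₀))) (sym (ℤP.-1*i≡-i s)) (sym (pow-C2-step e)) ⟩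
    P * (sgn (suc e) * (+ (p ^ (suc e C 2)) * + g₁)) - Q * (s * (κ * + g₀))
      ≡⟨ sym (cong₂ (λ x y → P * x - Q * y) (bpp-gauss r (suc e)) (bpp-gauss r e)) ⟩
    P * bpp r p (suc e) - Q * bpp r p e  ∎
    where
    open ≡-Reasoning
    s κ Q P : ℤ
    s  = sgn e
    κ  = + (p ^ (e C 2))
    Q  = + (p ^ e)
    P  = + (p ^ suc e)
    g₁ g₀ : ℕ
    g₁ = gauss r (suc e)
    g₀ = gauss r e
    expand : ∀ s κ Q P x y → - s * ((κ * Q) * (P * x + y)) ≡ P * (- s * ((κ * Q) * x)) - Q * (s * (κ * y))
    expand = solve-∀

  -- telescoping the q-Pascal rule:  Σ_{i=0}^{e} b_{r+1}(p^(e-i)) = p^e b_r(p^e)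
  bpp-telescope : ∀ r e → sum₀ e (λ i → bpp (suc r) p (e ℕ.∸ i)) ≡ + (p ^ e) * bpp r p e
  bpp-telescope r zero    = refl
  bpp-telescope r (suc e) = trans (cong₂ _+_ (bpp-pascal r e) (bpp-telescope r e)) (cancel _ _)
    where
    cancel : ∀ x y → (x - y) + y ≡ x
    cancel = solve-∀

  -- (0 choose e+1)_p = 0, so b_0 vanishes at nontrivial prime powers
  bpp-vanish : ∀ e → bpp 0 p (suc e) ≡ + 0
  bpp-vanish e = trans (bpp-gauss 0 (suc e))
    (trans (cong (sgn (suc e) *_) (ℤP.*-zeroʳ (+ (p ^ (suc e C 2))))) (ℤP.*-zeroʳ (sgn (suc e))))

-- a(n) = (-1)^(n+1) only depends on the parity of n, hence is multiplicative at every prime.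

sgn-2+ : ∀ n → sgn (suc (suc n)) ≡ sgn n
sgn-2+ n = trans (ℤP.-1*i≡-i _) (trans (cong -_ (ℤP.-1*i≡-i _)) (ℤP.neg-involutive _))

a-parity : ∀ n → a n ≡ (if does (2 ∣? n) then -[1+ 0 ] else + 1)
a-parity zero             = refl
a-parity (suc zero)       = refl
a-parity (suc (suc n)) with 2 ∣? n
... | yes 2∣n = trans (sgn-2+ (suc n)) (trans (a-parity n) (trans (if-yes (2 ∣? n) 2∣n)
                        (sym (if-yes (2 ∣? suc (suc n)) (∣m∣n⇒∣m+n (∣-refl {2}) 2∣n)))))
... | no  2∤n = trans (sgn-2+ (suc n)) (trans (a-parity n) (trans (if-no (2 ∣? n) 2∤n)
                        (sym (if-no (2 ∣? suc (suc n)) (λ 2∣ → 2∤n (∣m+n∣m⇒∣n 2∣ (∣-refl {2})))))))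

a-even : ∀ {n} → 2 ∣ n → a n ≡ -[1+ 0 ]
a-even {n} 2∣n = trans (a-parity n) (if-yes (2 ∣? n) 2∣n)

a-odd : ∀ {n} → 2 ∤ n → a n ≡ + 1
a-odd {n} 2∤n = trans (a-parity n) (if-no (2 ∣? n) 2∤n)

a-mul-oddˡ : ∀ x y → 2 ∤ x → a (x ℕ.* y) ≡ a x * a y
a-mul-oddˡ x y 2∤x with 2 ∣? y
... | yes 2∣y = trans (a-even (∣-trans 2∣y (n∣m*n x))) (sym (cong₂ _*_ (a-odd 2∤x) (a-even 2∣y)))
... | no  2∤y = trans (a-odd 2∤xy) (sym (cong₂ _*_ (a-odd 2∤x) (a-odd 2∤y)))
  where
  2∤xy : 2 ∤ x ℕ.* y
  2∤xy 2∣xy with euclidsLemma x y prime[2] 2∣xy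
  ... | inj₁ 2∣x = 2∤x 2∣x
  ... | inj₂ 2∣y = 2∤y 2∣y

odd-prime-pow : ∀ {p} → Prime p → p ≢ 2 → ∀ i → 2 ∤ p ^ i
odd-prime-pow pp p≢2 i 2∣p^i = p≢2 (sym (prime∣prime^⇒≡ prime[2] pp i 2∣p^i))

-- a is multiplicative at p with local factors a(p^i): the cofactor, or p^i, is odd.
a-multiplicativeAt : ∀ p → Prime p → MultiplicativeAt p (λ i → a (p ^ i)) a
a-multiplicativeAt p pp i d _ p∤d with p ℕ.≟ 2
... | yes refl = trans (cong a (ℕP.*-comm (2 ^ i) d)) (trans (a-mul-oddˡ d (2 ^ i) p∤d) (ℤP.*-comm (a d) (a (2 ^ i))))
... | no  p≢2  = a-mul-oddˡ (p ^ i) d (odd-prime-pow pp p≢2 i)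

cLocal : ℕ → ℕ → ℕ → ℤ
cLocal r p = (λ i → a (p ^ i)) ⋆ bpp (suc r) p

c-multiplicativeAt : ∀ r p → Prime p → MultiplicativeAt p (cLocal r p) (c (suc r))
c-multiplicativeAt r p pp =
  ∗-multiplicativeAt p {λ i → a (p ^ i)} {bpp (suc r) p} {a} {b (suc r)} pp
    (a-multiplicativeAt p pp) (b-multiplicativeAt (suc r) p pp)

-- For odd p all signs a(p^i) are 1 and the local factor telescopes to p^e b_r(p^e).
cLocal-odd : ∀ r p e → Prime p → p ≢ 2 → cLocal r p e ≡ + (p ^ e) * bpp r p e
cLocal-odd r p e pp p≢2 = trans (sum₀-cong e signsOne) (GaussianBinomial.bpp-telescope p (prime≥2 pp) r e)
  where
  signsOne : ∀ i → i ≤ e → a (p ^ i) * bpp (suc r) p (e ℕ.∸ i) ≡ bpp (suc r) p (e ℕ.∸ i)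
  signsOne i _ = trans (cong (_* bpp (suc r) p (e ℕ.∸ i)) (a-odd (odd-prime-pow pp p≢2 i))) (ℤP.*-identityˡ _)

-- For p = 2 the signs a(2^i) = -1 (i ≥ 1) turn the telescope into a difference.
cLocal-two : ∀ r e → cLocal r 2 (suc e) ≡ + (2 ^ suc e) * bpp r 2 (suc e) - + 2 * (+ (2 ^ e) * bpp r 2 e)
cLocal-two r e = begin
  + 1 * bpp (suc r) 2 (suc e) + sum₀ e (λ i → a (2 ^ suc i) * bpp (suc r) 2 (e ℕ.∸ i))
    ≡⟨ cong₂ _+_ (ℤP.*-identityˡ (bpp (suc r) 2 (suc e))) (sum₀-cong e signsMinusOne) ⟩
  bpp (suc r) 2 (suc e) + sum₀ e (λ i → bpp (suc r) 2 (e ℕ.∸ i) * -[1+ 0 ])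
    ≡⟨ cong (_+_ (bpp (suc r) 2 (suc e))) (sum₀-scaleʳ e (λ i → bpp (suc r) 2 (e ℕ.∸ i)) -[1+ 0 ]) ⟩
  bpp (suc r) 2 (suc e) + sum₀ e (λ i → bpp (suc r) 2 (e ℕ.∸ i)) * -[1+ 0 ]
    ≡⟨ cong₂ (λ x y → x + y * -[1+ 0 ]) (Binom₂.bpp-pascal r e) (Binom₂.bpp-telescope r e) ⟩
  (+ (2 ^ suc e) * bpp r 2 (suc e) - + (2 ^ e) * bpp r 2 e) + (+ (2 ^ e) * bpp r 2 e) * -[1+ 0 ]
    ≡⟨ collect (+ (2 ^ suc e) * bpp r 2 (suc e)) (+ (2 ^ e) * bpp r 2 e) ⟩
  + (2 ^ suc e) * bpp r 2 (suc e) - + 2 * (+ (2 ^ e) * bpp r 2 e)  ∎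
  where
  open ≡-Reasoning
  module Binom₂ = GaussianBinomial 2 (s≤s (s≤s z≤n))
  signsMinusOne : ∀ i → i ≤ e → a (2 ^ suc i) * bpp (suc r) 2 (e ℕ.∸ i) ≡ bpp (suc r) 2 (e ℕ.∸ i) * -[1+ 0 ]
  signsMinusOne i _ = trans (cong (_* bpp (suc r) 2 (e ℕ.∸ i)) (a-even (m∣m*n (2 ^ i)))) (ℤP.*-comm -[1+ 0 ] _)
  collect : ∀ x y → (x - y) + y * -[1+ 0 ] ≡ x - + 2 * y
  collect = solve-∀

R : ℕ → ℕ → ℤ
R r n = + n * (b r n - bHalf r n)

bHalf-even : ∀ r {n} → 2 ∣ n → bHalf r n ≡ b r (n ÷ 2)
bHalf-even r {n} = if-yes (2 ∣? n)

bHalf-odd : ∀ r {n} → 2 ∤ n → bHalf r n ≡ + 0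
bHalf-odd r {n} = if-no (2 ∣? n)

-- For odd p, halving commutes with removing p^i, so n ↦ b_r(n/2) has the local factors of b_r.
bHalf-multiplicativeAt-odd : ∀ r p → Prime p → p ≢ 2 → MultiplicativeAt p (bpp r p) (bHalf r)
bHalf-multiplicativeAt-odd r p pp p≢2 i m 1≤m p∤m with 2 ∣? m
... | yes 2∣m@(divides k m≡k2) = begin
  bHalf r (p ^ i ℕ.* m)           ≡⟨ bHalf-even r (∣-trans 2∣m (n∣m*n (p ^ i))) ⟩
  b r ((p ^ i ℕ.* m) ÷ 2)         ≡⟨ cong (b r) half ⟩
  b r (p ^ i ℕ.* k)               ≡⟨ b-multiplicativeAt r p pp i k (quotient-pos 1≤m m≡k2) p∤k ⟩
  bpp r p i * b r k               ≡⟨ cong (λ x → bpp r p i * b r x) (sym m/2) ⟩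
  bpp r p i * b r (m ÷ 2)         ≡⟨ cong (bpp r p i *_) (sym (bHalf-even r 2∣m)) ⟩
  bpp r p i * bHalf r m           ∎
  where
  open ≡-Reasoning
  m/2 : m ÷ 2 ≡ k
  m/2 = trans (cong (_÷ 2) m≡k2) (÷-cancel k 2 (s≤s z≤n))
  p∤k : p ∤ k
  p∤k p∣k = p∤m (∣-trans p∣k (divides 2 (trans m≡k2 (ℕP.*-comm k 2))))
  half : (p ^ i ℕ.* m) ÷ 2 ≡ p ^ i ℕ.* k
  half = trans (cong (λ x → (p ^ i ℕ.* x) ÷ 2) m≡k2)
               (trans (cong (_÷ 2) (sym (ℕP.*-assoc (p ^ i) k 2))) (÷-cancel (p ^ i ℕ.* k) 2 (s≤s z≤n)))
... | no 2∤m = begin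
  bHalf r (p ^ i ℕ.* m)           ≡⟨ bHalf-odd r 2∤p^im ⟩
  + 0                             ≡⟨ sym (ℤP.*-zeroʳ (bpp r p i)) ⟩
  bpp r p i * + 0                 ≡⟨ cong (bpp r p i *_) (sym (bHalf-odd r 2∤m)) ⟩
  bpp r p i * bHalf r m           ∎
  where
  open ≡-Reasoning
  2∤p^im : 2 ∤ p ^ i ℕ.* m
  2∤p^im 2∣ with euclidsLemma (p ^ i) m prime[2] 2∣
  ... | inj₁ 2∣p^i = odd-prime-pow pp p≢2 i 2∣p^i
  ... | inj₂ 2∣m   = 2∤m 2∣m

R-multiplicativeAt-odd : ∀ r p → Prime p → p ≢ 2 → MultiplicativeAt p (λ i → + (p ^ i) * bpp r p i) (R r)
R-multiplicativeAt-odd r p pp p≢2 i m 1≤m p∤m = begin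
  + (p ^ i ℕ.* m) * (b r (p ^ i ℕ.* m) - bHalf r (p ^ i ℕ.* m))
    ≡⟨ cong₂ _*_ (ℤP.pos-* (p ^ i) m) (cong₂ _-_ (b-multiplicativeAt r p pp i m 1≤m p∤m)
                                                 (bHalf-multiplicativeAt-odd r p pp p≢2 i m 1≤m p∤m)) ⟩
  (+ (p ^ i) * + m) * (bpp r p i * b r m - bpp r p i * bHalf r m)
    ≡⟨ regroup (+ (p ^ i)) (+ m) (bpp r p i) (b r m) (bHalf r m) ⟩
  (+ (p ^ i) * bpp r p i) * R r m  ∎
  where
  open ≡-Reasoning
  regroup : ∀ P M β x y → (P * M) * (β * x - β * y) ≡ (P * β) * (M * (x - y))
  regroup = solve-∀

-- For m odd, R_r(2^(e+1) m) = (2^(e+1) b_r(2^(e+1)) - 2 · 2^e b_r(2^e)) R_r(m),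
-- since 2^(e+1) m halves to 2^e m while m/2 does not occur.
R-multiplicativeAt-two : ∀ r e m → 1 ≤ m → 2 ∤ m →
  R r (2 ^ suc e ℕ.* m) ≡ (+ (2 ^ suc e) * bpp r 2 (suc e) - + 2 * (+ (2 ^ e) * bpp r 2 e)) * R r m
R-multiplicativeAt-two r e m 1≤m 2∤m = begin
  + (2 ^ suc e ℕ.* m) * (b r (2 ^ suc e ℕ.* m) - bHalf r (2 ^ suc e ℕ.* m))
    ≡⟨ cong₂ _*_ (trans (ℤP.pos-* (2 ^ suc e) m) (cong (_* + m) (ℤP.pos-* 2 (2 ^ e))))
                 (cong₂ _-_ (b₂ (suc e)) (trans halved (b₂ e))) ⟩
  (+ 2 * Q * + m) * (β₁ * b r m - β₀ * b r m)
    ≡⟨ regroup (+ 2) Q (+ m) β₁ β₀ (b r m) ⟩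
  (+ 2 * Q * β₁ - + 2 * (Q * β₀)) * (+ m * (b r m - + 0))
    ≡⟨ cong₂ (λ x y → (x * β₁ - + 2 * (Q * β₀)) * (+ m * (b r m - y)))
             (sym (ℤP.pos-* 2 (2 ^ e))) (sym (bHalf-odd r 2∤m)) ⟩
  (+ (2 ^ suc e) * β₁ - + 2 * (Q * β₀)) * R r m  ∎
  where
  open ≡-Reasoning
  Q β₁ β₀ : ℤ
  Q  = + (2 ^ e)
  β₁ = bpp r 2 (suc e)
  β₀ = bpp r 2 e
  b₂ : ∀ i → b r (2 ^ i ℕ.* m) ≡ bpp r 2 i * b r m
  b₂ i = b-multiplicativeAt r 2 prime[2] i m 1≤m 2∤m
  halved : bHalf r (2 ^ suc e ℕ.* m) ≡ b r (2 ^ e ℕ.* m)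
  halved = trans (bHalf-even r (∣-trans (m∣m*n (2 ^ e)) (m∣m*n m)))
                 (cong (b r) (trans (cong (_÷ 2) (^-suc-* 2 e m)) (÷-cancel (2 ^ e ℕ.* m) 2 (s≤s z≤n))))
  regroup : ∀ T Q M x y z → (T * Q * M) * (x * z - y * z) ≡ (T * Q * x - T * (Q * y)) * (M * (z - + 0))
  regroup = solve-∀

R-multiplicativeAt : ∀ r p → Prime p → MultiplicativeAt p (cLocal r p) (R r)
R-multiplicativeAt r p pp zero    m _ _ = trans (cong (R r) (ℕP.*-identityˡ m)) (sym (ℤP.*-identityˡ (R r m)))
R-multiplicativeAt r p pp (suc e) m 1≤m p∤m with p ℕ.≟ 2
... | yes refl = trans (R-multiplicativeAt-two r e m 1≤m p∤m) (cong (_* R r m) (sym (cLocal-two r e)))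
... | no  p≢2  = trans (R-multiplicativeAt-odd r p pp p≢2 (suc e) m 1≤m p∤m)
                       (cong (_* R r m) (sym (cLocal-odd r p (suc e) pp p≢2)))

c-succ≡R : ∀ r n → 1 ≤ n → c (suc r) n ≡ R r n
c-succ≡R r = agree-by-local-factors (c (suc r)) (R r) (cLocal r) refl (c-multiplicativeAt r) (R-multiplicativeAt r)

-- b_0(n) = 0 for n ≥ 2, since (0 choose e)_p = 0 for e ≥ 1.
b₀-vanish : ∀ n → 2 ≤ n → b 0 n ≡ + 0
b₀-vanish n 2≤n with primePowerPart-of n 2≤n
... | primePowerPart p e m pp n≡ 1≤m p∤m = begin
  b 0 n                       ≡⟨ cong (b 0) n≡ ⟩
  b 0 (p ^ suc e ℕ.* m)       ≡⟨ b-multiplicativeAt 0 p pp (suc e) m 1≤m p∤m ⟩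
  bpp 0 p (suc e) * b 0 m     ≡⟨ cong (_* b 0 m) (GaussianBinomial.bpp-vanish p (prime≥2 pp) e) ⟩
  + 0                         ∎
  where open ≡-Reasoning

-- Hence R_0(n) = 0 for n ≥ 3: both n and n/2 (if n is even) are at least 2.
R₀-vanish : ∀ n → 3 ≤ n → R 0 n ≡ + 0
R₀-vanish n 3≤n = trans (cong₂ (λ x y → + n * (x - y)) (b₀-vanish n (ℕP.≤-pred (ℕP.m≤n⇒m≤1+n 3≤n))) half-vanish)
                        (ℤP.*-zeroʳ (+ n))
  where
  half-vanish : bHalf 0 n ≡ + 0
  half-vanish with 2 ∣? n
  ... | no  2∤n = bHalf-odd 0 2∤n
  ... | yes 2∣n@(divides k n≡k2) = trans (bHalf-even 0 2∣n)
          (trans (cong (b 0) (trans (cong (_÷ 2) n≡k2) (÷-cancel k 2 (s≤s z≤n)))) (b₀-vanish k 2≤k))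
    where
    2≤half : ∀ k → 3 ≤ k ℕ.* 2 → 2 ≤ k
    2≤half (suc zero)    (s≤s (s≤s ()))
    2≤half (suc (suc _)) _ = s≤s (s≤s z≤n)
    2≤k : 2 ≤ k
    2≤k = 2≤half k (subst (3 ≤_) n≡k2 3≤n)

proposition4p6 : (c 1 1 ≡ + 1) × (c 1 2 ≡ -[1+ 1 ]) × ((n : ℕ) → 3 ≤ n → c 1 n ≡ + 0)
                 × ((r n : ℕ) → 1 ≤ r → 1 ≤ n → c (suc r) n ≡ + n * (b r n - bHalf r n))
proposition4p6 = refl , refl , c₁-vanish , λ r n _ → c-succ≡R r n
  where
  c₁-vanish : (n : ℕ) → 3 ≤ n → c 1 n ≡ + 0
  c₁-vanish n 3≤n = trans (c-succ≡R 0 n (ℕP.≤-trans (s≤s z≤n) 3≤n)) (R₀-vanish n 3≤n)
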